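{- Let $G=(V,E)$ be a directed graph. For every edge $(x,y)\in E$ there exists precisely one minimal non-empty passage $P_{(x,y)}$ of $G$ such that $(x,y)\in P_{(x,y)}$.
   Context: A directed graph is a pair $G=(V,E)$ with $E\subseteq V\times V$. A set $P\subseteq E$ is a passage of $G$ if for every $(x,y)\in P$ and all $x',y'\in V$ with $(x,y')\in E$ and $(x',y)\in E$, we have $(x,y')\in P$ and $(x',y)\in P$. A passage $P$ is minimal if there is no non-empty passage $P'$ of $G$ with $P'\subsetneq P$. -}

module Defs where

open import Level using (Level; suc; _⊔_)
open import Data.Product using (Σ; ∃; _×_; _,_)

record Digraph (ℓ : Level) : Set (suc ℓ) where
  field
    V : Set ℓ
    E : V → V → Set ℓ

module _ {ℓ : Level} (G : Digraph ℓ) where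
  open Digraph G

  EdgeSet : Set (suc ℓ)
  EdgeSet = V → V → Set ℓ

  _⊆ₑ_ : EdgeSet → EdgeSet → Set ℓ
  P ⊆ₑ Q = ∀ {x y} → P x y → Q x y

  _≐ₑ_ : EdgeSet → EdgeSet → Set ℓ
  P ≐ₑ Q = (P ⊆ₑ Q) × (Q ⊆ₑ P)

  NonEmpty : EdgeSet → Set ℓ
  NonEmpty P = Σ V λ x → Σ V λ y → P x y

  IsPassage : EdgeSet → Set ℓ
  IsPassage P =
    (P ⊆ₑ E) ×
    (∀ {x y} → P x y →
       (∀ y' → E x y' → P x y') × (∀ x' → E x' y → P x' y))

  IsMinimalPassage : EdgeSet → Set (suc ℓ)
  IsMinimalPassage P =
    IsPassage P ×
    (∀ (P' : EdgeSet) → IsPassage P' → NonEmpty P' → P' ⊆ₑ P → P ⊆ₑ P')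

module Submission where

-- P₍ₓ,ᵧ₎ is defined inductively as the least relation containing (x,y)
-- and closed under the two passage rules (replace the head or the tail of
-- an edge by any other edge sharing that endpoint).  Three facts about it:
--   * it is a passage containing (x,y);
--   * it is the least such passage: every passage containing (x,y)
--     contains P₍ₓ,ᵧ₎ (induction on the generation);
--   * the generation can be run backwards: every passage meeting P₍ₓ,ᵧ₎
--     contains (x,y), because each rule application is reversible.
-- Together these give minimality of P₍ₓ,ᵧ₎.  Uniqueness follows from a
-- general remark: a minimal passage equals each of its non-empty
-- sub-passages, and P₍ₓ,ᵧ₎ is a sub-passage of every passage through (x,y).

open import Defs
open import Level using (Level)
open import Data.Product using (Σ; _×_; _,_; proj₁; proj₂)

module PassageRules {ℓ : Level} (G : Digraph ℓ) where
  open Digraph G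

  closed-out : ∀ {P} → IsPassage G P → ∀ {a b b'} → P a b → E a b' → P a b'
  closed-out isP p e = proj₁ (proj₂ isP p) _ e

  closed-in : ∀ {P} → IsPassage G P → ∀ {a a' b} → P a b → E a' b → P a' b
  closed-in isP p e = proj₂ (proj₂ isP p) _ e

  minimal-≐-subpassage : ∀ {Q P} → IsMinimalPassage G Q →
    IsPassage G P → NonEmpty G P → _⊆ₑ_ G P Q → _≐ₑ_ G Q P
  minimal-≐-subpassage minQ isP neP P⊆Q = proj₂ minQ _ isP neP P⊆Q , P⊆Q

module GeneratedPassage {ℓ : Level} (G : Digraph ℓ)
                        {x y : Digraph.V G} (exy : Digraph.E G x y) where
  open Digraph G
  open PassageRules G

  data Generated : V → V → Set ℓ where
    seed    : Generated x y
    via-out : ∀ {a b b'} → Generated a b → E a b' → Generated a b'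
    via-in  : ∀ {a a' b} → Generated a b → E a' b → Generated a' b

  generated⊆E : ∀ {a b} → Generated a b → E a b
  generated⊆E seed          = exy
  generated⊆E (via-out _ e) = e
  generated⊆E (via-in _ e)  = e

  generated-isPassage : IsPassage G Generated
  generated-isPassage =
    generated⊆E , λ g → (λ _ e → via-out g e) , (λ _ e → via-in g e)

  generated-nonEmpty : NonEmpty G Generated
  generated-nonEmpty = x , y , seed

  generated-least : ∀ {P} → IsPassage G P → P x y → _⊆ₑ_ G Generated P
  generated-least isP pxy seed          = pxy
  generated-least isP pxy (via-out g e) = closed-out isP (generated-least isP pxy g) e
  generated-least isP pxy (via-in g e)  = closed-in isP (generated-least isP pxy g) e

  -- Reversibility: a passage containing any edge of P₍ₓ,ᵧ₎ contains (x,y).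
  -- A step (a,b) ↦ (a,b') is undone by the step (a,b') ↦ (a,b), which is
  -- allowed since (a,b) is itself an edge.
  generated-reaches-seed : ∀ {P} → IsPassage G P → ∀ {a b} → Generated a b → P a b → P x y
  generated-reaches-seed isP seed          p = p
  generated-reaches-seed isP (via-out g _) p =
    generated-reaches-seed isP g (closed-out isP p (generated⊆E g))
  generated-reaches-seed isP (via-in g _)  p =
    generated-reaches-seed isP g (closed-in isP p (generated⊆E g))

  -- A non-empty sub-passage of P₍ₓ,ᵧ₎ contains (x,y), hence all of P₍ₓ,ᵧ₎.
  generated-minimal : IsMinimalPassage G Generated
  generated-minimal = generated-isPassage , shrink
    where
    shrink : ∀ P → IsPassage G P → NonEmpty G P → _⊆ₑ_ G P Generated → _⊆ₑ_ G Generated P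
    shrink P isP (_ , _ , p) P⊆gen =
      generated-least isP (generated-reaches-seed isP (P⊆gen p) p)

mainTheorem5 : {ℓ : Level} (G : Digraph ℓ) →
    ∀ {x y} → Digraph.E G x y →
    Σ (EdgeSet G) λ P →
    (IsMinimalPassage G P × NonEmpty G P × P x y) ×
    (∀ (Q : EdgeSet G) → IsMinimalPassage G Q → NonEmpty G Q → Q x y → _≐ₑ_ G Q P)
mainTheorem5 G {x} {y} exy =
  Generated , (generated-minimal , generated-nonEmpty , seed) , unique
  where
  open PassageRules G
  open GeneratedPassage G exy
  unique : ∀ Q → IsMinimalPassage G Q → NonEmpty G Q → Q x y → _≐ₑ_ G Q Generated
  unique Q minQ _ qxy =
    minimal-≐-subpassage minQ generated-isPassage generated-nonEmpty
      (generated-least (proj₁ minQ) qxy)
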